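{- Let $t$ be a positive integer, let $\mathcal A\in I(n,t)$ be maximal, fixed and compressed, let $g\in G_*(\mathcal A)$, and choose $\hat E\in g$ with $s^+(\hat E)=s^+(g)$. Let $\mathscr D(\hat E)=\{\sigma\in S_n:\mathrm{fix}(\sigma)\cap[s^+(\hat E)]=\hat E\}$. Then $\mathscr D(\hat E)=\mathscr U_p(\hat E)\setminus\mathscr U_p(g\setminus\{\hat E\})$, and $$|\mathscr D(\hat E)|=\sum_{j=0}^{s^+(\hat E)-|\hat E|}(-1)^j\binom{s^+(\hat E)-|\hat E|}{j}\,(n-|\hat E|-j)!.$$
   Context: $S_n$ is the symmetric group on $[n]=\{1,\dots,n\}$; $\mathrm{fix}(\sigma)=\{x:\sigma(x)=x\}$; $[m]=\{1,\dots,m\}$. Two permutations have a cycle in common if that cycle appears in both cycle decompositions (1-cycles count). $\mathcal A\subseteq S_n$ is $t$-cycle-intersecting if any two distinct members have at least $t$ common cycles; $I(n,t)$ is the collection of all such families; $\mathcal A\in I(n,t)$ is maximal if no $\sigma\notin\mathcal A$ can be added keeping the property. Fixing: for $i\ne j$, ${}_{[ij]}\sigma=\sigma$ if $\sigma(i)\ne j$; if $\sigma(i)=j$, ${}_{[ij]}\sigma(i)=i$, ${}_{[ij]}\sigma(\sigma^{ -1}(i))=j$, ${}_{[ij]}\sigma(x)=\sigma(x)$ otherwise; $\triangleleft_{ij}(\mathcal A)=\{\triangleleft_{ij}(\sigma):\sigma\in\mathcal A\}$ with $\triangleleft_{ij}(\sigma)={}_{[ij]}\sigma$ if ${}_{[ij]}\sigma\notin\mathcal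 A$, else $\sigma$; $\mathcal A$ is fixed if $\triangleleft_{ij}(\mathcal A)=\mathcal A$ for all $i\ne j$. Compression: for $i<j$, $\sigma_{i,j}=\sigma$ if $\sigma(i)=i$ or $\sigma(j)\ne j$; otherwise $\sigma_{i,j}(i)=i$, $\sigma_{i,j}(j)=\sigma(i)$, $\sigma_{i,j}(\sigma^{ -1}(i))=j$, $\sigma_{i,j}(y)=\sigma(y)$ otherwise; $\mathcal C_{i,j}(\mathcal A)=\{\mathcal C_{i,j}(\sigma):\sigma\in\mathcal A\}$ with $\mathcal C_{i,j}(\sigma)=\sigma_{i,j}$ if $\sigma_{i,j}\notin\mathcal A$, else $\sigma$; $\mathcal A$ is compressed if $\mathcal C_{i,j}(\mathcal A)=\mathcal A$ for all $i<j$. $\mathscr U_p(B)=\{\sigma: B\subseteq\mathrm{fix}(\sigma)\}$, $\mathscr U_p(\mathcal B)=\bigcup_{B\in\mathcal B}\mathscr U_p(B)$; a generating set for $\mathcal A$ is a collection $g$ of subsets of $[n]$ with no set of size $n-1$ and $\mathscr U_p(g)=\mathcal A$; $G(\mathcal A)$ is the set of generating sets. For $B=\{b_1<\dots<b_k\}$, $\mathscr L(B)=\{\{a_1<\dots<a_k\}\subseteq[n]: a_i\le b_i\ \forall i\}$; $\mathscr L(g)=\bigcup_{B\in g}\mathscr L(B)$; $\mathscr L_*(g)$ is the set of inclusion-minimal elements of $\mathscr L(g)$. $G_*(\mathcal A)=\{g\in G(\mathcal A):\mathscr L_*(g)=g\}$. $s^+(E)$ is the largest element of $E$, and $s^+(g)=\max_{E\in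 g}s^+(E)$. -}

module Defs where

open import Data.Bool using (Bool; true; false; if_then_else_; _∧_)
open import Data.Nat as ℕ using (ℕ; zero; suc; _≤_; _<_; _⊔_; _∸_; _<ᵇ_; _≤ᵇ_)
open import Data.Nat.Combinatorics using (_C_)
open import Data.Integer as ℤ using (ℤ; +_; -1ℤ)
open import Data.Fin using (Fin; toℕ; _<_)
open import Data.Fin.Properties using (_≟_)
open import Data.Fin.Subset using (Subset; _⊆_; _∩_; ∣_∣)
open import Data.Vec using (Vec; []; _∷_; lookup; tabulate)
open import Data.List as List using (List; []; _∷_; length; filterᵇ; upTo; allFin)
open import Data.Bool.ListAction using (and)
open import Data.List.Relation.Binary.Pointwise using (Pointwise)
open import Data.List.Relation.Unary.Unique.Propositional using (Unique)
open import Data.List.Membership.Propositional using () renaming (_∈_ to _∈ˡ_)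
open import Data.Product using (Σ; ∃; _×_; _,_)
open import Data.Sum using (_⊎_)
open import Function using (_∘_; id; _⇔_)
open import Relation.Nullary using (¬_; ⌊_⌋)
open import Relation.Binary.PropositionalEquality using (_≡_; _≢_)

-- Convention: [n] = {1,…,n} is modelled by Fin n, the element x : Fin n
-- standing for the number toℕ x + 1.

-- Permutations of [n] as vectors (one-line notation σ = (σ(1),…,σ(n)))

Arr : ℕ → Set
Arr n = Vec (Fin n) n

app : ∀ {n} → Arr n → Fin n → Fin n
app = lookup

-- σ ∈ S_n  (an injective self-map of a finite set)
IsPerm : ∀ {n} → Arr n → Set
IsPerm {n} σ = ∀ (i j : Fin n) → app σ i ≡ app σ j → i ≡ j

Family : ℕ → Set₁
Family n = Arr n → Set

iter : ∀ {n} → Arr n → ℕ → Fin n → Fin n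
iter σ zero    x = x
iter σ (suc k) x = app σ (iter σ k x)

-- the σ-cycle through x is also a cycle of τ: τ agrees with σ on the
-- σ-orbit of x (orbits have length ≤ n)
sameCycleAt : ∀ {n} → Arr n → Arr n → Fin n → Bool
sameCycleAt {n} σ τ x =
  and (List.map (λ k → ⌊ app σ (iter σ k x) ≟ app τ (iter σ k x) ⌋) (upTo n))

-- x is the least element of its σ-cycle (one representative per cycle)
cycleRep : ∀ {n} → Arr n → Fin n → Bool
cycleRep {n} σ x = and (List.map (λ k → toℕ x ≤ᵇ toℕ (iter σ k x)) (upTo n))

-- number of cycles (1-cycles included) common to σ and τ
commonCycles : ∀ {n} → Arr n → Arr n → ℕ
commonCycles {n} σ τ =
  length (filterᵇ (λ x → sameCycleAt σ τ x ∧ cycleRep σ x) (allFin n))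

CycleIntersecting : (n t : ℕ) → Family n → Set
CycleIntersecting n t 𝒜 =
  (∀ σ → 𝒜 σ → IsPerm σ) ×
  (∀ σ τ → 𝒜 σ → 𝒜 τ → σ ≢ τ → t ≤ commonCycles σ τ)

Maximal : (n t : ℕ) → Family n → Set
Maximal n t 𝒜 =
  CycleIntersecting n t 𝒜 ×
  (∀ σ → IsPerm σ → ¬ 𝒜 σ →
     ¬ CycleIntersecting n t (λ τ → 𝒜 τ ⊎ τ ≡ σ))

_≐_ : ∀ {n} → Family n → Family n → Set
𝒜 ≐ ℬ = ∀ σ → 𝒜 σ ⇔ ℬ σ

fixOp : ∀ {n} → Fin n → Fin n → Arr n → Arr n
fixOp i j σ =
  if ⌊ app σ i ≟ j ⌋
  then tabulate (λ x → if ⌊ x ≟ i ⌋ then i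
                       else if ⌊ app σ x ≟ i ⌋ then j else app σ x)
  else σ

fixFam : ∀ {n} → Fin n → Fin n → Family n → Family n
fixFam i j 𝒜 τ =
  Σ _ λ σ → 𝒜 σ ×
    ((¬ 𝒜 (fixOp i j σ) × τ ≡ fixOp i j σ) ⊎ (𝒜 (fixOp i j σ) × τ ≡ σ))

Fixed : ∀ {n} → Family n → Set
Fixed {n} 𝒜 = ∀ (i j : Fin n) → i ≢ j → fixFam i j 𝒜 ≐ 𝒜

compOp : ∀ {n} → Fin n → Fin n → Arr n → Arr n
compOp i j σ =
  if ⌊ app σ i ≟ i ⌋ then σ
  else if ⌊ app σ j ≟ j ⌋
  then tabulate (λ x → if ⌊ x ≟ i ⌋ then i
                       else if ⌊ x ≟ j ⌋ then app σ i
                       else if ⌊ app σ x ≟ i ⌋ then j else app σ x)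
  else σ

compFam : ∀ {n} → Fin n → Fin n → Family n → Family n
compFam i j 𝒜 τ =
  Σ _ λ σ → 𝒜 σ ×
    ((¬ 𝒜 (compOp i j σ) × τ ≡ compOp i j σ) ⊎ (𝒜 (compOp i j σ) × τ ≡ σ))

Compressed : ∀ {n} → Family n → Set
Compressed {n} 𝒜 = ∀ (i j : Fin n) → i Data.Fin.< j → compFam i j 𝒜 ≐ 𝒜

fix : ∀ {n} → Arr n → Subset n
fix σ = tabulate (λ x → ⌊ app σ x ≟ x ⌋)

Coll : ℕ → Set₁
Coll n = Subset n → Set

Up : ∀ {n} → Subset n → Family n
Up B σ = IsPerm σ × B ⊆ fix σ

Upᶜ : ∀ {n} → Coll n → Family n
Upᶜ ℬ σ = Σ _ λ B → ℬ B × Up B σ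

IsGenerating : ∀ {n} → Family n → Coll n → Set
IsGenerating {n} 𝒜 g =
  (∀ B → g B → ∣ B ∣ ≢ n ∸ 1) × (Upᶜ g ≐ 𝒜)

-- elements of a subset in increasing order (0-based values; only order matters)
elems : ∀ {n} → Subset n → List ℕ
elems []           = []
elems (true  ∷ p)  = 0 ∷ List.map suc (elems p)
elems (false ∷ p)  = List.map suc (elems p)

InL : ∀ {n} → Subset n → Subset n → Set
InL A B = Pointwise _≤_ (elems A) (elems B)

Lg : ∀ {n} → Coll n → Coll n
Lg g A = Σ _ λ B → g B × InL A B

Lstar : ∀ {n} → Coll n → Coll n
Lstar g A = Lg g A × (∀ A′ → Lg g A′ → A′ ⊆ A → A′ ≡ A)

IsGeneratingStar : ∀ {n} → Family n → Coll n → Set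
IsGeneratingStar 𝒜 g = IsGenerating 𝒜 g × (∀ E → Lstar g E ⇔ g E)

-- s⁺(E): largest element of E (as a number in {1,…,n}; 0 for E = ∅)
sPlus : ∀ {n} → Subset n → ℕ
sPlus E = List.foldr (λ x m → suc x ⊔ m) 0 (elems E)

upto : ∀ {n} → ℕ → Subset n
upto m = tabulate (λ x → toℕ x <ᵇ m)

D : ∀ {n} → Subset n → Family n
D E σ = IsPerm σ × fix σ ∩ upto (sPlus E) ≡ E

HasSize : ∀ {n} → Family n → ℕ → Set
HasSize {n} 𝒜 k =
  Σ (List (Arr n)) λ xs → Unique xs × (∀ σ → σ ∈ˡ xs ⇔ 𝒜 σ) × length xs ≡ k

sumTo : ℕ → (ℕ → ℤ) → ℤ
sumTo zero    f = f 0
sumTo (suc m) f = sumTo m f ℤ.+ f (suc m)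

module Submission where

-- If fix σ ∩ [s] = Ê, a generator B ⊆ fix σ lies in [s⁺(B)] ⊆ [s], hence in Ê,
-- and since g = ℒ_*(g) is an antichain, B = Ê.  Conversely, if Ê ⊆ fix σ and some x < s outside Ê
-- were fixed, replacing the maximum of Ê by x would give a member of ℒ(Ê) ⊆ ℒ(g) inside fix σ (the
-- shift lemma); an inclusion-minimal member of ℒ(g) below it is a generator other than Ê in fix σ.
--
-- The count.  𝒟(Ê) consists of the permutations fixing Ê pointwise with no fixed point in [s] ∖ Ê.
-- The permutations fixing F pointwise number (n - ∣F∣)!: sorted by the image of a point s ∉ F, each
-- nonempty fibre is matched with the permutations fixing F ∪ {s} by a transposition.  Forbidding
-- the fixed points of R one at a time gives the recurrence incExc e (m+1) = incExc e m - incExc (e+1) m,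
-- which the alternating sum satisfies by Pascal's rule.

open import Defs
open import Data.Nat as ℕ using (ℕ; zero; suc; _+_; _∸_; _≤_; _<_; _!; z≤n; s≤s; _<ᵇ_) renaming (_*_ to _*ℕ_)
import Data.Nat.Properties as ℕP
open import Data.Nat.Combinatorics using (_C_; nCk+nC[k+1]≡[n+1]C[k+1]; k>n⇒nCk≡0)
open import Data.Integer as ℤ using (ℤ; +_; -1ℤ; _*_; _^_; -_)
import Data.Integer.Properties as ℤP
open import Data.Integer.Tactic.RingSolver using (solve-∀)
open import Data.Bool as Bool using (true; false; if_then_else_; _∧_; not)
open import Data.Bool.Properties using (T-≡)
open import Data.Fin as Fin using (Fin; toℕ)
open import Data.Fin.Properties as FinP using (_≟_; all?)
open import Data.Fin.Permutation.Components using (transpose; transpose-inverse)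
open import Data.Fin.Subset using (Subset; ∣_∣; _⊂_; _∩_) renaming (_∈_ to _∈ₛ_; _⊆_ to _⊆ₛ_)
import Data.Fin.Subset.Properties as SubsetP
open import Data.Vec as Vec using (Vec; []; _∷_; lookup; tabulate)
import Data.Vec.Properties as VecP
open import Data.List as List using (List; []; _∷_; length; filter; map; cartesianProductWith; allFin)
open import Data.List.Properties using (filter-≐; filter-accept; filter-reject; filter-none)
open import Data.List.Membership.Propositional using (_∈_)
open import Data.List.Membership.Propositional.Properties
  using (∈-map⁺; ∈-map⁻; ∈-filter⁺; ∈-filter⁻; ∈-allFin; ∈-cartesianProductWith⁺)
open import Data.List.Membership.Propositional.Properties.WithK using (unique∧set⇒bag)
import Data.List.Relation.Unary.All as All
open import Data.List.Relation.Unary.Any using (here; there)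
open import Data.List.Relation.Unary.Unique.Propositional using (Unique)
open import Data.List.Relation.Binary.Pointwise as Pointwise using (Pointwise; []; _∷_)
import Data.List.Relation.Binary.Pointwise.Properties as PointwiseP
import Data.List.Relation.Unary.Unique.Propositional.Properties as Unique
import Data.List.Relation.Unary.AllPairs as AllPairs
open import Data.List.Relation.Binary.BagAndSetEquality using (∼bag⇒↭)
open import Data.List.Relation.Binary.Permutation.Propositional.Properties using (filter-↭; ↭-length)
open import Data.Product using (Σ; _×_; _,_; proj₁; proj₂)
open import Data.Sum using (_⊎_; inj₁; inj₂)
open import Data.Empty using (⊥; ⊥-elim)
open import Function using (_∘_; id; _⇔_; mk⇔; Equivalence)
open import Relation.Nullary using (¬_; Dec; yes; no; does; ⌊_⌋)
open import Relation.Nullary.Decidable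
  using (_×-dec_; _→-dec_; ¬?; dec-true; dec-false; ¬¬-excluded-middle; decidable-stable)
open import Relation.Unary using (Decidable)
open import Relation.Binary.PropositionalEquality
open import Algebra.Properties.CommutativeMonoid.Sum ℕP.+-0-commutativeMonoid
  using (sum-syntax; sum-cong-≗; sum-replicate-zero; ∑-distrib-+)

module _ {A : Set} where

  count : {P : A → Set} → Decidable P → List A → ℕ
  count P? xs = length (filter P? xs)

  count-≐ : {P Q : A → Set} (P? : Decidable P) (Q? : Decidable Q) →
    (∀ x → P x → Q x) → (∀ x → Q x → P x) → ∀ xs → count P? xs ≡ count Q? xs
  count-≐ P? Q? P⇒Q Q⇒P xs = cong length (filter-≐ P? Q? ((λ {x} → P⇒Q x) , (λ {x} → Q⇒P x)) xs)

  count-none : {P : A → Set} (P? : Decidable P) → (∀ x → ¬ P x) → ∀ xs → count P? xs ≡ 0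
  count-none P? ¬P xs = cong length (filter-none P? (All.universal ¬P xs))

  count-split : {P S : A → Set} (P? : Decidable P) (S? : Decidable S) → ∀ xs →
    count P? xs ≡ count (λ x → P? x ×-dec S? x) xs + count (λ x → P? x ×-dec ¬? (S? x)) xs
  count-split P? S? [] = refl
  count-split P? S? (x ∷ xs) with P? x | S? x
  ... | yes _ | yes _ = cong suc (count-split P? S? xs)
  ... | yes _ | no _  = trans (cong suc (count-split P? S? xs)) (sym (ℕP.+-suc _ _))
  ... | no _  | yes _ = count-split P? S? xs
  ... | no _  | no _  = count-split P? S? xs

  count-map : {P : A → Set} (P? : Decidable P) (f : A → A) → ∀ xs →
    count P? (map f xs) ≡ count (P? ∘ f) xs
  count-map P? f [] = refl
  count-map P? f (x ∷ xs) with P? (f x)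
  ... | yes _ = cong suc (count-map P? f xs)
  ... | no _  = count-map P? f xs

  count-single : {P : A → Set} (P? : Decidable P) (a : A) → P a → (∀ {x} → P x → x ≡ a) →
    ∀ xs → Unique xs → a ∈ xs → count P? xs ≡ 1
  count-single P? a pa only (x ∷ xs) (a∉xs AllPairs.∷ _) (here refl) =
    trans (cong length (filter-accept P? pa))
      (cong suc (cong length (filter-none P? (All.map (λ a≢y py → a≢y (sym (only py))) a∉xs))))
  count-single {P} P? a pa only (x ∷ xs) (x∉xs AllPairs.∷ u) (there a∈xs) =
    trans (cong length (filter-reject P? ¬px)) (count-single P? a pa only xs u a∈xs)
    where
    ¬px : ¬ P x
    ¬px px = All.lookup x∉xs a∈xs (only px)

  count-enumeration : {P : A → Set} (P? : Decidable P) {xs ys : List A} →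
    Unique xs → Unique ys → (∀ {z} → z ∈ xs ⇔ z ∈ ys) → count P? xs ≡ count P? ys
  count-enumeration P? uxs uys same =
    ↭-length (filter-↭ P? (∼bag⇒↭ (unique∧set⇒bag uxs uys same)))

allVec : (n k : ℕ) → List (Vec (Fin n) k)
allVec n zero    = [] ∷ []
allVec n (suc k) = cartesianProductWith _∷_ (allFin n) (allVec n k)

allVec-complete : ∀ n k (v : Vec (Fin n) k) → v ∈ allVec n k
allVec-complete n zero    []      = here refl
allVec-complete n (suc k) (a ∷ v) =
  ∈-cartesianProductWith⁺ _∷_ (∈-allFin a) (allVec-complete n k v)

allVec-unique : ∀ n k → Unique (allVec n k)
allVec-unique n zero    = All.[] AllPairs.∷ AllPairs.[]
allVec-unique n (suc k) =
  Unique.cartesianProductWith⁺ _∷_ VecP.∷-injective (Unique.allFin⁺ n) (allVec-unique n k)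

allArr : (n : ℕ) → List (Arr n)
allArr n = allVec n n

#_ : ∀ {n} {P : Arr n → Set} → Decidable P → ℕ
#_ {n} P? = count P? (allArr n)

#-bijection : ∀ {n} {P : Arr n → Set} (P? : Decidable P) (f f⁻¹ : Arr n → Arr n) →
  (∀ σ → f (f⁻¹ σ) ≡ σ) → (∀ σ → f⁻¹ (f σ) ≡ σ) → # P? ≡ # (P? ∘ f)
#-bijection {n} P? f f⁻¹ right left = begin
  count P? (allArr n)          ≡⟨ count-enumeration P? (allVec-unique n n) f[all]-unique f[all]-same ⟩
  count P? (map f (allArr n))  ≡⟨ count-map P? f (allArr n) ⟩
  count (P? ∘ f) (allArr n)    ∎
  where
  open ≡-Reasoning
  f-injective : ∀ {σ τ} → f σ ≡ f τ → σ ≡ τ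
  f-injective {σ} {τ} e = trans (sym (left σ)) (trans (cong f⁻¹ e) (left τ))
  f[all]-unique : Unique (map f (allArr n))
  f[all]-unique = Unique.map⁺ f-injective (allVec-unique n n)
  f[all]-same : ∀ {σ} → σ ∈ allArr n ⇔ σ ∈ map f (allArr n)
  f[all]-same {σ} = mk⇔
    (λ _ → subst (_∈ map f (allArr n)) (right σ) (∈-map⁺ f (allVec-complete n n (f⁻¹ σ))))
    (λ _ → allVec-complete n n σ)

∑-indicator : ∀ {n} (a : Fin n) → ∑[ t < n ] (if does (a ≟ t) then 1 else 0) ≡ 1
∑-indicator {suc n} Fin.zero    = cong suc (sum-replicate-zero n)
∑-indicator {suc n} (Fin.suc a) = ∑-indicator a

∑-complement : ∀ {m} (p : Subset m) c →
  ∑[ t < m ] (if lookup p t then 0 else c) ≡ (m ∸ ∣ p ∣) *ℕ c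
∑-complement []          c = refl
∑-complement (true ∷ p)  c = ∑-complement p c
∑-complement {suc m} (false ∷ p) c = begin
  c + ∑[ t < m ] (if lookup p t then 0 else c)  ≡⟨ cong (ℕ._+_ c) (∑-complement p c) ⟩
  c + (m ∸ ∣p∣) *ℕ c                            ≡⟨ cong (_*ℕ c) (sym (ℕP.+-∸-assoc 1 (SubsetP.∣p∣≤n p))) ⟩
  (suc m ∸ ∣p∣) *ℕ c                            ∎
  where
  open ≡-Reasoning
  ∣p∣ = ∣ p ∣

module _ {A : Set} {n : ℕ} {P : A → Set} (P? : Decidable P) (h : A → Fin n) where

  fibre : (t : Fin n) → Decidable (λ x → P x × h x ≡ t)
  fibre t x = P? x ×-dec (h x ≟ t)

  fibre-cons : ∀ {x} → P x → ∀ xs t →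
    count (fibre t) (x ∷ xs) ≡ (if does (h x ≟ t) then 1 else 0) + count (fibre t) xs
  fibre-cons {x} px xs t with P? x
  ... | no ¬px = ⊥-elim (¬px px)
  ... | yes _ with h x ≟ t
  ...   | yes _ = refl
  ...   | no _  = refl

  count-fibres : ∀ xs → count P? xs ≡ ∑[ t < n ] count (fibre t) xs
  count-fibres [] = sym (sum-replicate-zero n)
  count-fibres (x ∷ xs) = by-cases (P? x)
    where
    open ≡-Reasoning
    by-cases : Dec (P x) → count P? (x ∷ xs) ≡ ∑[ t < n ] count (fibre t) (x ∷ xs)
    by-cases (no ¬px) = begin
      count P? (x ∷ xs)                    ≡⟨ cong length (filter-reject P? ¬px) ⟩
      count P? xs                          ≡⟨ count-fibres xs ⟩
      ∑[ t < n ] count (fibre t) xs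
        ≡⟨ sum-cong-≗ (λ t → sym (cong length (filter-reject (fibre t) (¬px ∘ proj₁)))) ⟩
      ∑[ t < n ] count (fibre t) (x ∷ xs)  ∎
    by-cases (yes px) = begin
      count P? (x ∷ xs)
        ≡⟨ cong length (filter-accept P? px) ⟩
      1 + count P? xs
        ≡⟨ cong₂ _+_ (sym (∑-indicator (h x))) (count-fibres xs) ⟩
      ∑[ t < n ] (if does (h x ≟ t) then 1 else 0) + ∑[ t < n ] count (fibre t) xs
        ≡⟨ sym (∑-distrib-+ (λ t → if does (h x ≟ t) then 1 else 0) (λ t → count (fibre t) xs)) ⟩
      ∑[ t < n ] ((if does (h x ≟ t) then 1 else 0) + count (fibre t) xs)
        ≡⟨ sum-cong-≗ (λ t → sym (fibre-cons px xs t)) ⟩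
      ∑[ t < n ] count (fibre t) (x ∷ xs)  ∎

true≢false : true ≢ false
true≢false ()

∣insert∣ : ∀ {m} (p : Subset m) x → lookup p x ≡ false → ∣ p Vec.[ x ]≔ true ∣ ≡ suc ∣ p ∣
∣insert∣ (false ∷ p) Fin.zero    refl = refl
∣insert∣ (true ∷ p)  (Fin.suc x) x∉p  = cong suc (∣insert∣ p x x∉p)
∣insert∣ (false ∷ p) (Fin.suc x) x∉p  = ∣insert∣ p x x∉p

∣remove∣ : ∀ {m} (p : Subset m) x → lookup p x ≡ true → suc ∣ p Vec.[ x ]≔ false ∣ ≡ ∣ p ∣
∣remove∣ (true ∷ p)  Fin.zero    refl = refl
∣remove∣ (true ∷ p)  (Fin.suc x) x∈p  = cong suc (∣remove∣ p x x∈p)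
∣remove∣ (false ∷ p) (Fin.suc x) x∈p  = ∣remove∣ p x x∈p

insert-new : ∀ {m} (p : Subset m) s → lookup (p Vec.[ s ]≔ true) s ≡ true
insert-new p s = VecP.lookup∘update s p true

insert-old : ∀ {m} (p : Subset m) s {x} → lookup p x ≡ true → lookup (p Vec.[ s ]≔ true) x ≡ true
insert-old p s {x} x∈p with s ≟ x
... | yes refl = insert-new p s
... | no s≢x   = trans (VecP.lookup∘update′ (s≢x ∘ sym) p true) x∈p

insert-member : ∀ {m} (p : Subset m) s {x} → lookup (p Vec.[ s ]≔ true) x ≡ true → x ≡ s ⊎ lookup p x ≡ true
insert-member p s {x} x∈p+s with s ≟ x
... | yes s≡x = inj₁ (sym s≡x)
... | no s≢x  = inj₂ (trans (sym (VecP.lookup∘update′ (s≢x ∘ sym) p true)) x∈p+s)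

remove-gone : ∀ {m} (p : Subset m) r → lookup (p Vec.[ r ]≔ false) r ≡ false
remove-gone p r = VecP.lookup∘update r p false

remove-old : ∀ {m} (p : Subset m) r {x} → lookup p x ≡ true → x ≢ r → lookup (p Vec.[ r ]≔ false) x ≡ true
remove-old p r x∈p x≢r = trans (VecP.lookup∘update′ x≢r p false) x∈p

remove-member : ∀ {m} (p : Subset m) r {x} → lookup (p Vec.[ r ]≔ false) x ≡ true → lookup p x ≡ true
remove-member p r {x} x∈p-r with r ≟ x
... | yes refl = ⊥-elim (true≢false (trans (sym x∈p-r) (remove-gone p r)))
... | no r≢x   = trans (sym (VecP.lookup∘update′ (r≢x ∘ sym) p false)) x∈p-r

full-member : ∀ {m} (p : Subset m) → ∣ p ∣ ≡ m → ∀ x → lookup p x ≡ true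
full-member p ∣p∣≡m x =
  trans (cong (λ q → lookup q x) (SubsetP.∣p∣≡n⇒p≡⊤ {p = p} ∣p∣≡m)) (VecP.lookup-replicate x true)

empty-nonmember : ∀ {m} (p : Subset m) → ∣ p ∣ ≡ 0 → ∀ x → lookup p x ≡ false
empty-nonmember (false ∷ p) ∣p∣≡0 Fin.zero    = refl
empty-nonmember (false ∷ p) ∣p∣≡0 (Fin.suc x) = empty-nonmember p ∣p∣≡0 x

some-nonmember : ∀ {m} (p : Subset m) → ∣ p ∣ < m → Σ (Fin m) λ s → lookup p s ≡ false
some-nonmember (false ∷ p) _         = Fin.zero , refl
some-nonmember (true ∷ p)  (s≤s lt) with some-nonmember p lt
... | s , s∉p = Fin.suc s , s∉p

some-member : ∀ {m k} (p : Subset m) → ∣ p ∣ ≡ suc k → Σ (Fin m) λ r → lookup p r ≡ true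
some-member (true ∷ p)  _ = Fin.zero , refl
some-member (false ∷ p) ∣p∣≡1+k with some-member p ∣p∣≡1+k
... | r , r∈p = Fin.suc r , r∈p

transpose-left : ∀ {m} (s t : Fin m) → transpose s t s ≡ t
transpose-left s t rewrite dec-true (s ≟ s) refl = refl

transpose-other : ∀ {m} (s t : Fin m) {x} → x ≢ s → x ≢ t → transpose s t x ≡ x
transpose-other s t {x} x≢s x≢t rewrite dec-false (x ≟ s) x≢s | dec-false (x ≟ t) x≢t = refl

transpose-injective : ∀ {m} (s t : Fin m) {x y} → transpose s t x ≡ transpose s t y → x ≡ y
transpose-injective s t {x} {y} e =
  trans (sym (transpose-inverse t s)) (trans (cong (transpose t s) e) (transpose-inverse t s))

vec-ext : ∀ {A : Set} {m} (u v : Vec A m) → (∀ i → lookup u i ≡ lookup v i) → u ≡ v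
vec-ext u v same =
  trans (sym (VecP.tabulate∘lookup u)) (trans (VecP.tabulate-cong same) (VecP.tabulate∘lookup v))

-- Permutations of [n] with prescribed fixed points.

module FixedPoints (n : ℕ) where

  isPerm? : Decidable (IsPerm {n})
  isPerm? σ = all? (λ i → all? (λ j → (app σ i ≟ app σ j) →-dec (i ≟ j)))

  Fixes : Subset n → Arr n → Set
  Fixes F σ = ∀ x → lookup F x ≡ true → app σ x ≡ x

  fixes? : ∀ F → Decidable (Fixes F)
  fixes? F σ = all? (λ x → (lookup F x Bool.≟ true) →-dec (app σ x ≟ x))

  Avoids : Subset n → Arr n → Set
  Avoids R σ = ∀ x → lookup R x ≡ true → app σ x ≢ x

  avoids? : ∀ R → Decidable (Avoids R)
  avoids? R σ = all? (λ x → (lookup R x Bool.≟ true) →-dec ¬? (app σ x ≟ x))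

  fixing? : ∀ F → Decidable (λ σ → IsPerm σ × Fixes F σ)
  fixing? F σ = isPerm? σ ×-dec fixes? F σ

  fixing-avoiding? : ∀ F R → Decidable (λ σ → IsPerm σ × Fixes F σ × Avoids R σ)
  fixing-avoiding? F R σ = isPerm? σ ×-dec fixes? F σ ×-dec avoids? R σ

  identity : Arr n
  identity = tabulate id

  _⊙_ : (Fin n → Fin n) → Arr n → Arr n
  τ ⊙ σ = tabulate (λ x → τ (app σ x))

  app-⊙ : ∀ τ σ x → app (τ ⊙ σ) x ≡ τ (app σ x)
  app-⊙ τ σ x = VecP.lookup∘tabulate _ x

  ⊙-inverse : ∀ (τ τ⁻¹ : Fin n → Fin n) → (∀ x → τ (τ⁻¹ x) ≡ x) → ∀ σ → τ ⊙ (τ⁻¹ ⊙ σ) ≡ σ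
  ⊙-inverse τ τ⁻¹ inv σ = vec-ext _ σ λ x →
    trans (app-⊙ τ (τ⁻¹ ⊙ σ) x) (trans (cong τ (app-⊙ τ⁻¹ σ x)) (inv (app σ x)))

  ⊙-perm : ∀ τ → (∀ {x y} → τ x ≡ τ y → x ≡ y) → ∀ {σ} → IsPerm σ → IsPerm (τ ⊙ σ)
  ⊙-perm τ τ-inj {σ} σ-perm i j eq =
    σ-perm i j (τ-inj (trans (sym (app-⊙ τ σ i)) (trans eq (app-⊙ τ σ j))))

  ⊙-perm⁻¹ : ∀ τ {σ} → IsPerm (τ ⊙ σ) → IsPerm σ
  ⊙-perm⁻¹ τ {σ} τσ-perm i j eq =
    τσ-perm i j (trans (app-⊙ τ σ i) (trans (cong τ eq) (sym (app-⊙ τ σ j))))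

  at : Fin n → Arr n → Fin n
  at s σ = app σ s

  -- no permutation fixing F sends a point s ∉ F to a point t ∈ F (t is already σ t)
  fibre-inside : ∀ F s t → lookup F s ≡ false → lookup F t ≡ true →
    # fibre (fixing? F) (at s) t ≡ 0
  fibre-inside F s t s∉F t∈F = count-none _ impossible (allArr n)
    where
    impossible : ∀ σ → ¬ ((IsPerm σ × Fixes F σ) × app σ s ≡ t)
    impossible σ ((σ-perm , σ-fixes) , σs≡t) =
      true≢false (trans (sym t∈F) (trans (cong (lookup F) (sym s≡t)) s∉F))
      where
      s≡t : s ≡ t
      s≡t = σ-perm s t (trans σs≡t (sym (σ-fixes t t∈F)))

  -- for s, t ∉ F, composing with the transposition (s t) matches the permutations
  -- fixing F with s ↦ t to the permutations fixing F ∪ {s}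
  fibre-outside : ∀ F s t → lookup F s ≡ false → lookup F t ≡ false →
    # fibre (fixing? F) (at s) t ≡ # fixing? (F Vec.[ s ]≔ true)
  fibre-outside F s t s∉F t∉F = begin
    # fibre (fixing? F) (at s) t
      ≡⟨ #-bijection _ (τ ⊙_) (transpose t s ⊙_) (⊙-inverse τ (transpose t s) (λ _ → transpose-inverse s t))
                                                 (⊙-inverse (transpose t s) τ (λ _ → transpose-inverse t s)) ⟩
    # (λ σ → fibre (fixing? F) (at s) t (τ ⊙ σ))
      ≡⟨ count-≐ (λ σ → fibre (fixing? F) (at s) t (τ ⊙ σ)) (fixing? (F Vec.[ s ]≔ true)) to from (allArr n) ⟩
    # fixing? (F Vec.[ s ]≔ true)  ∎
    where
    open ≡-Reasoning
    τ : Fin n → Fin n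
    τ = transpose s t
    τ-inj : ∀ {x y} → τ x ≡ τ y → x ≡ y
    τ-inj = transpose-injective s t
    τ-fixes-F : ∀ x → lookup F x ≡ true → τ x ≡ x
    τ-fixes-F x x∈F = transpose-other s t (λ { refl → true≢false (trans (sym x∈F) s∉F) })
                                          (λ { refl → true≢false (trans (sym x∈F) t∉F) })
    to : ∀ σ → (IsPerm (τ ⊙ σ) × Fixes F (τ ⊙ σ)) × app (τ ⊙ σ) s ≡ t →
         IsPerm σ × Fixes (F Vec.[ s ]≔ true) σ
    to σ ((τσ-perm , τσ-fixes) , τσs≡t) = ⊙-perm⁻¹ τ {σ} τσ-perm , fixes
      where
      fixes : Fixes (F Vec.[ s ]≔ true) σ
      fixes x x∈F+s with insert-member F s x∈F+s
      ... | inj₁ refl = τ-inj (trans (sym (app-⊙ τ σ s)) (trans τσs≡t (sym (transpose-left s t))))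
      ... | inj₂ x∈F  = τ-inj (trans (sym (app-⊙ τ σ x)) (trans (τσ-fixes x x∈F) (sym (τ-fixes-F x x∈F))))
    from : ∀ σ → IsPerm σ × Fixes (F Vec.[ s ]≔ true) σ →
           (IsPerm (τ ⊙ σ) × Fixes F (τ ⊙ σ)) × app (τ ⊙ σ) s ≡ t
    from σ (σ-perm , σ-fixes) = (⊙-perm τ τ-inj {σ} σ-perm , fixes) , τσs≡t
      where
      fixes : Fixes F (τ ⊙ σ)
      fixes x x∈F = trans (app-⊙ τ σ x) (trans (cong τ (σ-fixes x (insert-old F s x∈F))) (τ-fixes-F x x∈F))
      τσs≡t : app (τ ⊙ σ) s ≡ t
      τσs≡t = trans (app-⊙ τ σ s) (trans (cong τ (σ-fixes s (insert-new F s))) (transpose-left s t))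

  identity-perm : IsPerm identity
  identity-perm i j eq = trans (sym (VecP.lookup∘tabulate id i)) (trans eq (VecP.lookup∘tabulate id j))

  #fixing : ∀ d F → n ∸ ∣ F ∣ ≡ d → # fixing? F ≡ d !
  #fixing zero F n∸∣F∣≡0 =
    count-single (fixing? F) identity (identity-perm , λ x _ → VecP.lookup∘tabulate id x) only
      (allArr n) (allVec-unique n n) (allVec-complete n n identity)
    where
    F-full : ∀ x → lookup F x ≡ true
    F-full = full-member F (ℕP.≤-antisym (SubsetP.∣p∣≤n F) (ℕP.m∸n≡0⇒m≤n n∸∣F∣≡0))
    only : ∀ {σ} → IsPerm σ × Fixes F σ → σ ≡ identity
    only {σ} (_ , σ-fixes) =
      vec-ext σ identity λ x → trans (σ-fixes x (F-full x)) (sym (VecP.lookup∘tabulate id x))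
  #fixing (suc d) F n∸∣F∣≡1+d = begin
    # fixing? F                                  ≡⟨ count-fibres (fixing? F) (at s) (allArr n) ⟩
    ∑[ t < n ] # fibre (fixing? F) (at s) t      ≡⟨ sum-cong-≗ fibre-size ⟩
    ∑[ t < n ] (if lookup F t then 0 else d !)   ≡⟨ ∑-complement F (d !) ⟩
    (n ∸ ∣ F ∣) *ℕ d !                           ≡⟨ cong (_*ℕ d !) n∸∣F∣≡1+d ⟩
    suc d !                                      ∎
    where
    open ≡-Reasoning
    nonmember : Σ (Fin n) λ s → lookup F s ≡ false
    nonmember = some-nonmember F (ℕP.m∸n≢0⇒n<m (λ eq → ℕP.0≢1+n (trans (sym eq) n∸∣F∣≡1+d)))
    s = proj₁ nonmember
    s∉F = proj₂ nonmember
    n∸∣F+s∣≡d : n ∸ ∣ F Vec.[ s ]≔ true ∣ ≡ d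
    n∸∣F+s∣≡d = begin
      n ∸ ∣ F Vec.[ s ]≔ true ∣  ≡⟨ cong (n ∸_) (∣insert∣ F s s∉F) ⟩
      n ∸ suc ∣ F ∣              ≡⟨ sym (ℕP.pred[m∸n]≡m∸[1+n] n ∣ F ∣) ⟩
      ℕ.pred (n ∸ ∣ F ∣)         ≡⟨ cong ℕ.pred n∸∣F∣≡1+d ⟩
      d                          ∎
    fibre-size : ∀ t → # fibre (fixing? F) (at s) t ≡ (if lookup F t then 0 else d !)
    fibre-size t with lookup F t in t∈?F
    ... | true  = fibre-inside F s t s∉F t∈?F
    ... | false = trans (fibre-outside F s t s∉F t∈?F) (#fixing d (F Vec.[ s ]≔ true) n∸∣F+s∣≡d)

sumTo-cong : ∀ m {f g : ℕ → ℤ} → (∀ j → f j ≡ g j) → sumTo m f ≡ sumTo m g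
sumTo-cong zero    f≗g = f≗g 0
sumTo-cong (suc m) f≗g = cong₂ ℤ._+_ (sumTo-cong m f≗g) (f≗g (suc m))

sumTo-shift : ∀ m f → sumTo (suc m) f ≡ f 0 ℤ.+ sumTo m (f ∘ suc)
sumTo-shift zero    f = refl
sumTo-shift (suc m) f = trans (cong (ℤ._+ f (suc (suc m))) (sumTo-shift m f)) (ℤP.+-assoc (f 0) _ _)

sumTo-+ : ∀ m f g → sumTo m (λ j → f j ℤ.+ g j) ≡ sumTo m f ℤ.+ sumTo m g
sumTo-+ zero    f g = refl
sumTo-+ (suc m) f g =
  trans (cong (ℤ._+ (f (suc m) ℤ.+ g (suc m))) (sumTo-+ m f g))
        (interchange (sumTo m f) (sumTo m g) (f (suc m)) (g (suc m)))
  where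
  interchange : ∀ a b c d → (a ℤ.+ b) ℤ.+ (c ℤ.+ d) ≡ (a ℤ.+ c) ℤ.+ (b ℤ.+ d)
  interchange = solve-∀

sumTo-neg : ∀ m f → sumTo m (λ j → - f j) ≡ - sumTo m f
sumTo-neg zero    f = refl
sumTo-neg (suc m) f =
  trans (cong (ℤ._+ (- f (suc m))) (sumTo-neg m f)) (sym (ℤP.neg-distrib-+ (sumTo m f) (f (suc m))))

-- The inclusion–exclusion numbers  incExc n e m = ∑_{j=0}^{m} (-1)^j (m choose j) (n - e - j)!,
-- which will count the permutations of [n] fixing e given points and no point of m others.

incExcTerm : (n e m j : ℕ) → ℤ
incExcTerm n e m j = (-1ℤ ^ j) * + ((m C j) *ℕ ((n ∸ e ∸ j) !))

incExc : (n e m : ℕ) → ℤ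
incExc n e m = sumTo m (incExcTerm n e m)

-- Pascal's rule, term by term
incExcTerm-pascal : ∀ n e m j →
  incExcTerm n e (suc m) (suc j) ≡ - incExcTerm n (suc e) m j ℤ.+ incExcTerm n e m (suc j)
incExcTerm-pascal n e m j = begin
  (-1ℤ ^ suc j) * + ((suc m C suc j) *ℕ k !)
    ≡⟨ cong (λ c → (-1ℤ ^ suc j) * + (c *ℕ k !)) (sym (nCk+nC[k+1]≡[n+1]C[k+1] m j)) ⟩
  (-1ℤ ^ suc j) * + ((m C j + m C suc j) *ℕ k !)
    ≡⟨ cong (λ c → (-1ℤ ^ suc j) * + c) (ℕP.*-distribʳ-+ (k !) (m C j) (m C suc j)) ⟩
  (-1ℤ ^ suc j) * + ((m C j) *ℕ k ! + (m C suc j) *ℕ k !)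
    ≡⟨ cong (λ c → (-1ℤ ^ suc j) * c) (ℤP.pos-+ ((m C j) *ℕ k !) ((m C suc j) *ℕ k !)) ⟩
  (-1ℤ ^ suc j) * (+ ((m C j) *ℕ k !) ℤ.+ + ((m C suc j) *ℕ k !))
    ≡⟨ ℤP.*-distribˡ-+ (-1ℤ ^ suc j) _ _ ⟩
  (-1ℤ ^ suc j) * + ((m C j) *ℕ k !) ℤ.+ (-1ℤ ^ suc j) * + ((m C suc j) *ℕ k !)
    ≡⟨ cong (ℤ._+ ((-1ℤ ^ suc j) * + ((m C suc j) *ℕ k !)))
            (trans (ℤP.*-assoc -1ℤ (-1ℤ ^ j) _) (ℤP.-1*i≡-i _)) ⟩
  - ((-1ℤ ^ j) * + ((m C j) *ℕ k !)) ℤ.+ (-1ℤ ^ suc j) * + ((m C suc j) *ℕ k !)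
    ≡⟨ cong (λ i → - ((-1ℤ ^ j) * + ((m C j) *ℕ i !)) ℤ.+ incExcTerm n e m (suc j)) k≡n∸[1+e]∸j ⟩
  - incExcTerm n (suc e) m j ℤ.+ incExcTerm n e m (suc j)  ∎
  where
  open ≡-Reasoning
  k = n ∸ e ∸ suc j
  k≡n∸[1+e]∸j : k ≡ n ∸ suc e ∸ j
  k≡n∸[1+e]∸j = begin
    n ∸ e ∸ suc j    ≡⟨ ℕP.∸-+-assoc n e (suc j) ⟩
    n ∸ (e + suc j)  ≡⟨ cong (n ∸_) (ℕP.+-suc e j) ⟩
    n ∸ suc (e + j)  ≡⟨ sym (ℕP.∸-+-assoc n (suc e) j) ⟩
    n ∸ suc e ∸ j    ∎

-- the recurrence mirroring inclusion–exclusion on one more forbidden fixed point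
incExc-step : ∀ n e m → incExc n e (suc m) ≡ incExc n e m ℤ.- incExc n (suc e) m
incExc-step n e m = begin
  incExc n e (suc m)
    ≡⟨ sumTo-shift m (incExcTerm n e (suc m)) ⟩
  t₀ ℤ.+ sumTo m (λ j → incExcTerm n e (suc m) (suc j))
    ≡⟨ cong (ℤ._+_ t₀) (sumTo-cong m (incExcTerm-pascal n e m)) ⟩
  t₀ ℤ.+ sumTo m (λ j → - incExcTerm n (suc e) m j ℤ.+ incExcTerm n e m (suc j))
    ≡⟨ cong (ℤ._+_ t₀) (trans (sumTo-+ m _ _) (cong (ℤ._+ rest) (sumTo-neg m (incExcTerm n (suc e) m)))) ⟩
  t₀ ℤ.+ (- incExc n (suc e) m ℤ.+ rest)
    ≡⟨ regroup t₀ (incExc n (suc e) m) rest ⟩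
  (t₀ ℤ.+ rest) ℤ.- incExc n (suc e) m
    ≡⟨ cong (ℤ._- incExc n (suc e) m) (trans (sym (sumTo-shift m (incExcTerm n e m))) last-vanishes) ⟩
  incExc n e m ℤ.- incExc n (suc e) m  ∎
  where
  open ≡-Reasoning
  t₀ = incExcTerm n e m 0
  rest = sumTo m (λ j → incExcTerm n e m (suc j))
  regroup : ∀ x y z → x ℤ.+ (- y ℤ.+ z) ≡ (x ℤ.+ z) ℤ.- y
  regroup = solve-∀
  -- the j = m + 1 term carries (m choose m+1) = 0
  last-vanishes : sumTo (suc m) (incExcTerm n e m) ≡ sumTo m (incExcTerm n e m)
  last-vanishes = begin
    sumTo m (incExcTerm n e m) ℤ.+ (-1ℤ ^ suc m) * + ((m C suc m) *ℕ ((n ∸ e ∸ suc m) !))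
      ≡⟨ cong (λ c → sumTo m (incExcTerm n e m) ℤ.+ (-1ℤ ^ suc m) * + (c *ℕ ((n ∸ e ∸ suc m) !)))
              (k>n⇒nCk≡0 (ℕP.n<1+n m)) ⟩
    sumTo m (incExcTerm n e m) ℤ.+ (-1ℤ ^ suc m) * + 0
      ≡⟨ cong (ℤ._+_ (sumTo m (incExcTerm n e m))) (ℤP.*-zeroʳ (-1ℤ ^ suc m)) ⟩
    sumTo m (incExcTerm n e m) ℤ.+ + 0
      ≡⟨ ℤP.+-identityʳ _ ⟩
    sumTo m (incExcTerm n e m)  ∎

-- Inclusion–exclusion: permutations with prescribed fixed points F and forbidden fixed points R.

module InclusionExclusion (n : ℕ) where
  open FixedPoints n

  Disjoint : Subset n → Subset n → Set
  Disjoint F R = ∀ x → lookup F x ≡ true → lookup R x ≡ true → ⊥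

  #fixing-avoiding-∅ : ∀ F R → ∣ R ∣ ≡ 0 → # fixing-avoiding? F R ≡ # fixing? F
  #fixing-avoiding-∅ F R ∣R∣≡0 =
    count-≐ (fixing-avoiding? F R) (fixing? F) (λ _ (σ-perm , σ-fixes , _) → σ-perm , σ-fixes)
      (λ _ (σ-perm , σ-fixes) → σ-perm , σ-fixes , λ x x∈R →
         ⊥-elim (true≢false (trans (sym x∈R) (empty-nonmember R ∣R∣≡0 x))))
      (allArr n)

  -- for r ∈ R: the permutations fixing F and avoiding R ∖ {r} either fix r, and then
  -- fix F ∪ {r}, or do not, and then avoid all of R
  #fixing-avoiding-split : ∀ F R r → lookup R r ≡ true →
    # fixing-avoiding? F (R Vec.[ r ]≔ false)
      ≡ # fixing-avoiding? (F Vec.[ r ]≔ true) (R Vec.[ r ]≔ false) + # fixing-avoiding? F R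
  #fixing-avoiding-split F R r r∈R =
    trans (count-split (fixing-avoiding? F R-r) (λ σ → app σ r ≟ r) (allArr n))
      (cong₂ _+_ (count-≐ _ (fixing-avoiding? F+r R-r) fixes-r fixes-r⁻¹ (allArr n))
                 (count-≐ _ (fixing-avoiding? F R) moves-r moves-r⁻¹ (allArr n)))
    where
    R-r = R Vec.[ r ]≔ false
    F+r = F Vec.[ r ]≔ true
    fixes-r : ∀ σ → (IsPerm σ × Fixes F σ × Avoids R-r σ) × app σ r ≡ r →
              IsPerm σ × Fixes F+r σ × Avoids R-r σ
    fixes-r σ ((σ-perm , σ-fixes , σ-avoids) , σr≡r) = σ-perm , fixes , σ-avoids
      where
      fixes : Fixes F+r σ
      fixes x x∈F+r with insert-member F r x∈F+r
      ... | inj₁ refl = σr≡r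
      ... | inj₂ x∈F  = σ-fixes x x∈F
    fixes-r⁻¹ : ∀ σ → IsPerm σ × Fixes F+r σ × Avoids R-r σ →
                (IsPerm σ × Fixes F σ × Avoids R-r σ) × app σ r ≡ r
    fixes-r⁻¹ σ (σ-perm , σ-fixes , σ-avoids) =
      (σ-perm , (λ x x∈F → σ-fixes x (insert-old F r x∈F)) , σ-avoids) , σ-fixes r (insert-new F r)
    moves-r : ∀ σ → (IsPerm σ × Fixes F σ × Avoids R-r σ) × app σ r ≢ r →
              IsPerm σ × Fixes F σ × Avoids R σ
    moves-r σ ((σ-perm , σ-fixes , σ-avoids) , σr≢r) = σ-perm , σ-fixes , avoids
      where
      avoids : Avoids R σ
      avoids x x∈R with x ≟ r
      ... | yes refl = σr≢r
      ... | no x≢r   = σ-avoids x (remove-old R r x∈R x≢r)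
    moves-r⁻¹ : ∀ σ → IsPerm σ × Fixes F σ × Avoids R σ →
                (IsPerm σ × Fixes F σ × Avoids R-r σ) × app σ r ≢ r
    moves-r⁻¹ σ (σ-perm , σ-fixes , σ-avoids) =
      (σ-perm , σ-fixes , (λ x x∈R-r → σ-avoids x (remove-member R r x∈R-r))) , σ-avoids r r∈R

  #fixing-avoiding : ∀ m F R → ∣ R ∣ ≡ m → Disjoint F R → + # fixing-avoiding? F R ≡ incExc n ∣ F ∣ m
  #fixing-avoiding zero F R ∣R∣≡0 _ = begin
    + # fixing-avoiding? F R                     ≡⟨ cong +_ (#fixing-avoiding-∅ F R ∣R∣≡0) ⟩
    + # fixing? F                                ≡⟨ cong +_ (#fixing (n ∸ ∣ F ∣) F refl) ⟩
    + ((n ∸ ∣ F ∣) !)                            ≡⟨ sym (trans (ℤP.*-identityˡ _) (cong +_ (ℕP.*-identityˡ _))) ⟩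
    incExc n ∣ F ∣ zero                          ∎
    where open ≡-Reasoning
  #fixing-avoiding (suc m) F R ∣R∣≡1+m F∩R=∅ = begin
    + (# fixing-avoiding? F R)
      ≡⟨ +c≡+a-+b (#fixing-avoiding-split F R r r∈R) ⟩
    (+ (# fixing-avoiding? F R-r)) ℤ.- (+ (# fixing-avoiding? F+r R-r))
      ≡⟨ cong₂ ℤ._-_ (#fixing-avoiding m F R-r ∣R-r∣≡m F∩R-r=∅)
                     (trans (#fixing-avoiding m F+r R-r ∣R-r∣≡m F+r∩R-r=∅)
                            (cong (λ e → incExc n e m) (∣insert∣ F r r∉F))) ⟩
    (incExc n ∣ F ∣ m) ℤ.- (incExc n (suc ∣ F ∣) m)
      ≡⟨ sym (incExc-step n ∣ F ∣ m) ⟩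
    incExc n ∣ F ∣ (suc m)  ∎
    where
    open ≡-Reasoning
    +c≡+a-+b : ∀ {a b c} → a ≡ b + c → + c ≡ (+ a) ℤ.- (+ b)
    +c≡+a-+b {a} {b} {c} refl = trans (cancel (+ c) (+ b)) (cong (ℤ._- + b) (sym (ℤP.pos-+ b c)))
      where
      cancel : ∀ y z → y ≡ (z ℤ.+ y) ℤ.- z
      cancel = solve-∀
    member = some-member R ∣R∣≡1+m
    r = proj₁ member
    r∈R = proj₂ member
    R-r = R Vec.[ r ]≔ false
    F+r = F Vec.[ r ]≔ true
    r∉F : lookup F r ≡ false
    r∉F with lookup F r in r∈?F
    ... | true  = ⊥-elim (F∩R=∅ r r∈?F r∈R)
    ... | false = refl
    ∣R-r∣≡m : ∣ R-r ∣ ≡ m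
    ∣R-r∣≡m = ℕP.suc-injective (trans (∣remove∣ R r r∈R) ∣R∣≡1+m)
    F∩R-r=∅ : Disjoint F R-r
    F∩R-r=∅ x x∈F x∈R-r = F∩R=∅ x x∈F (remove-member R r x∈R-r)
    F+r∩R-r=∅ : Disjoint F+r R-r
    F+r∩R-r=∅ x x∈F+r x∈R-r with insert-member F r x∈F+r
    ... | inj₁ refl = true≢false (trans (sym x∈R-r) (remove-gone R r))
    ... | inj₂ x∈F  = F∩R=∅ x x∈F (remove-member R r x∈R-r)

maxSuc : List ℕ → ℕ
maxSuc = List.foldr (λ x m → suc x ℕ.⊔ m) 0

maxSuc-bound : ∀ {a} l → a ∈ l → a < maxSuc l
maxSuc-bound (b ∷ l) (here refl) = ℕP.m≤m⊔n (suc b) (maxSuc l)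
maxSuc-bound (b ∷ l) (there a∈l) = ℕP.<-≤-trans (maxSuc-bound l a∈l) (ℕP.m≤n⊔m (suc b) (maxSuc l))

maxSuc-attained : ∀ l → l ≡ [] ⊎ Σ ℕ (λ a → a ∈ l × maxSuc l ≡ suc a)
maxSuc-attained [] = inj₁ refl
maxSuc-attained (b ∷ l) with maxSuc-attained l
... | inj₁ refl = inj₂ (b , here refl , ℕP.⊔-identityʳ (suc b))
... | inj₂ (a , a∈l , eq) rewrite eq with ℕP.⊔-sel b a
...   | inj₁ b⊔a≡b = inj₂ (b , here refl , cong suc b⊔a≡b)
...   | inj₂ b⊔a≡a = inj₂ (a , there a∈l , cong suc b⊔a≡a)

elems-sound : ∀ {m} (p : Subset m) {a} → a ∈ elems p → Σ (Fin m) λ x → toℕ x ≡ a × lookup p x ≡ true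
elems-sound (true ∷ p) (here refl) = Fin.zero , refl , refl
elems-sound (true ∷ p) (there a∈) with ∈-map⁻ suc a∈
... | b , b∈ , refl with elems-sound p b∈
...   | x , refl , x∈p = Fin.suc x , refl , x∈p
elems-sound (false ∷ p) a∈ with ∈-map⁻ suc a∈
... | b , b∈ , refl with elems-sound p b∈
...   | x , refl , x∈p = Fin.suc x , refl , x∈p

elems-complete : ∀ {m} (p : Subset m) x → lookup p x ≡ true → toℕ x ∈ elems p
elems-complete (true ∷ p)  Fin.zero    _   = here refl
elems-complete (true ∷ p)  (Fin.suc x) x∈p = there (∈-map⁺ suc (elems-complete p x x∈p))
elems-complete (false ∷ p) (Fin.suc x) x∈p = ∈-map⁺ suc (elems-complete p x x∈p)

sPlus-bound : ∀ {m} (p : Subset m) x → lookup p x ≡ true → toℕ x < sPlus p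
sPlus-bound p x x∈p = maxSuc-bound (elems p) (elems-complete p x x∈p)

sPlus-attained : ∀ {m} (p : Subset m) →
  sPlus p ≡ 0 ⊎ Σ (Fin m) λ M → lookup p M ≡ true × sPlus p ≡ suc (toℕ M)
sPlus-attained p with maxSuc-attained (elems p)
... | inj₁ elems≡[] = inj₁ (cong maxSuc elems≡[])
... | inj₂ (a , a∈ , eq) with elems-sound p a∈
...   | M , refl , M∈p = inj₂ (M , M∈p , eq)

sPlus-≤ : ∀ {m} (p : Subset m) → sPlus p ≤ m
sPlus-≤ p with sPlus-attained p
... | inj₁ eq           = subst (_≤ _) (sym eq) z≤n
... | inj₂ (M , _ , eq) = subst (_≤ _) (sym eq) (FinP.toℕ<n M)

-- The shift lemma: replacing the largest element M of E by a smaller non-member x yields a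
-- member of ℒ(E), as only the entry M of the increasing list moves, and it moves down.

IsMax : ∀ {m} → Subset m → Fin m → Set
IsMax p M = lookup p M ≡ true × (∀ y → lookup p y ≡ true → toℕ y ≤ toℕ M)

IsMax-tail : ∀ {m} {b} {p : Subset m} {M} → IsMax (b ∷ p) (Fin.suc M) → IsMax p M
IsMax-tail (M∈p , M-max) = M∈p , λ y y∈p → ℕP.≤-pred (M-max (Fin.suc y) y∈p)

≤-lift : ∀ {xs ys} → Pointwise _≤_ xs ys → Pointwise _≤_ (map suc xs) (map suc ys)
≤-lift = Pointwise.map⁺ suc suc ∘ Pointwise.map s≤s

max-to-front : ∀ {m} (q : Subset m) M → IsMax q M → InL (true ∷ (q Vec.[ M ]≔ false)) (false ∷ q)
max-to-front (true ∷ r)  Fin.zero    _     = z≤n ∷ PointwiseP.refl ℕP.≤-refl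
max-to-front (true ∷ r)  (Fin.suc M) M-max = z≤n ∷ ≤-lift (max-to-front r M (IsMax-tail M-max))
max-to-front (false ∷ r) (Fin.suc M) M-max = lower-head (≤-lift (max-to-front r M (IsMax-tail M-max)))
  where
  lower-head : ∀ {a xs ys} → Pointwise _≤_ (a ∷ xs) ys → Pointwise _≤_ (0 ∷ xs) ys
  lower-head (_ ∷ rest) = z≤n ∷ rest

shift-max-down : ∀ {m} (p : Subset m) x M → lookup p x ≡ false → IsMax p M → toℕ x < toℕ M →
  InL ((p Vec.[ M ]≔ false) Vec.[ x ]≔ true) p
shift-max-down (false ∷ q) Fin.zero    (Fin.suc M) _   M-max _        = max-to-front q M (IsMax-tail M-max)
shift-max-down (true ∷ q)  (Fin.suc x) (Fin.suc M) x∉p M-max (s≤s x<M) =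
  z≤n ∷ ≤-lift (shift-max-down q x M x∉p (IsMax-tail M-max) x<M)
shift-max-down (false ∷ q) (Fin.suc x) (Fin.suc M) x∉p M-max (s≤s x<M) =
  ≤-lift (shift-max-down q x M x∉p (IsMax-tail M-max) x<M)

⊆∧≢⇒⊂ : ∀ {m} {p q : Subset m} → p ⊆ₛ q → p ≢ q → p ⊂ q
⊆∧≢⇒⊂ {p = []}        {[]}        _   p≢q = ⊥-elim (p≢q refl)
⊆∧≢⇒⊂ {p = true ∷ p}  {false ∷ q} p⊆q _   with p⊆q Vec.here
... | ()
⊆∧≢⇒⊂ {p = false ∷ p} {true ∷ q}  p⊆q _   = SubsetP.out⊂in (SubsetP.drop-∷-⊆ p⊆q)
⊆∧≢⇒⊂ {p = true ∷ p}  {true ∷ q}  p⊆q p≢q =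
  SubsetP.s⊂s (⊆∧≢⇒⊂ (SubsetP.drop-∷-⊆ p⊆q) (p≢q ∘ cong (true ∷_)))
⊆∧≢⇒⊂ {p = false ∷ p} {false ∷ q} p⊆q p≢q =
  SubsetP.s⊂s (⊆∧≢⇒⊂ (SubsetP.drop-∷-⊆ p⊆q) (p≢q ∘ cong (false ∷_)))

module GeneratingStar {n} (g : Coll n) (g-star : ∀ E → Lstar g E ⇔ g E) where

  generator-antichain : ∀ {E B} → g E → g B → B ⊆ₛ E → B ≡ E
  generator-antichain {E} {B} gE gB B⊆E =
    proj₂ (Equivalence.from (g-star E) gE) B (B , gB , PointwiseP.refl ℕP.≤-refl) B⊆E

  -- every A ∈ ℒ(g) contains some generator: descend to an inclusion-minimal member of
  -- ℒ(g) inside A, which lies in ℒ_*(g) = g (stated negatively: ℒ(g) need not be decidable)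
  generator-below : ∀ A → Lg g A → (∀ B → g B → B ⊆ₛ A → ⊥) → ⊥
  generator-below A = descend (suc ∣ A ∣) A (ℕP.n<1+n ∣ A ∣)
    where
    descend : ∀ k A → ∣ A ∣ < k → Lg g A → (∀ B → g B → B ⊆ₛ A → ⊥) → ⊥
    descend (suc k) A ∣A∣<1+k A∈L none = ¬¬-excluded-middle by-cases
      where
      by-cases : Dec (Σ (Subset n) λ A′ → Lg g A′ × A′ ⊆ₛ A × A′ ≢ A) → ⊥
      by-cases (yes (A′ , A′∈L , A′⊆A , A′≢A)) =
        descend k A′ (ℕP.<-≤-trans (SubsetP.p⊂q⇒∣p∣<∣q∣ (⊆∧≢⇒⊂ A′⊆A A′≢A)) (ℕP.≤-pred ∣A∣<1+k)) A′∈L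
          (λ B gB B⊆A′ → none B gB (A′⊆A ∘ B⊆A′))
      by-cases (no no-smaller) = none A (Equivalence.to (g-star A) (A∈L , minimal)) id
        where
        minimal : ∀ A′ → Lg g A′ → A′ ⊆ₛ A → A′ ≡ A
        minimal A′ A′∈L A′⊆A =
          decidable-stable (VecP.≡-dec Bool._≟_ A′ A) (λ A′≢A → no-smaller (A′ , A′∈L , A′⊆A , A′≢A))

⌊⌋-true : ∀ {A : Set} (a? : Dec A) → ⌊ a? ⌋ ≡ true → A
⌊⌋-true (yes a) _ = a

⌊⌋-yes : ∀ {A : Set} (a? : Dec A) → A → ⌊ a? ⌋ ≡ true
⌊⌋-yes (yes _) _ = refl
⌊⌋-yes (no ¬a) a = ⊥-elim (¬a a)

<ᵇ-true : ∀ {a s} → (a <ᵇ s) ≡ true → a < s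
<ᵇ-true {a} {s} a<ᵇs = ℕP.<ᵇ⇒< a s (Equivalence.from T-≡ a<ᵇs)

<⇒<ᵇ-true : ∀ {a s} → a < s → (a <ᵇ s) ≡ true
<⇒<ᵇ-true a<s = Equivalence.to T-≡ (ℕP.<⇒<ᵇ a<s)

∧-true : ∀ {a b} → a ∧ b ≡ true → a ≡ true × b ≡ true
∧-true {true} b≡true = refl , b≡true

lookup-fix : ∀ {n} (σ : Arr n) x → lookup (fix σ) x ≡ ⌊ app σ x ≟ x ⌋
lookup-fix σ x = VecP.lookup∘tabulate _ x

fix⇒ : ∀ {n} (σ : Arr n) {x} → x ∈ₛ fix σ → app σ x ≡ x
fix⇒ σ {x} x∈fix = ⌊⌋-true (app σ x ≟ x) (trans (sym (lookup-fix σ x)) (VecP.[]=⇒lookup x∈fix))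

⇒fix : ∀ {n} (σ : Arr n) {x} → app σ x ≡ x → x ∈ₛ fix σ
⇒fix σ {x} σx≡x = VecP.lookup⇒[]= x (fix σ) (trans (lookup-fix σ x) (⌊⌋-yes (app σ x ≟ x) σx≡x))

lookup-fix∩upto : ∀ {n} (σ : Arr n) s x → lookup (fix σ ∩ upto s) x ≡ ⌊ app σ x ≟ x ⌋ ∧ (toℕ x <ᵇ s)
lookup-fix∩upto σ s x =
  trans (VecP.lookup-zipWith _∧_ x (fix σ) (upto s)) (cong₂ _∧_ (lookup-fix σ x) (VecP.lookup∘tabulate _ x))

module _ {n} (σ : Arr n) (E : Subset n) (s : ℕ) where

  restricted-fixes : fix σ ∩ upto s ≡ E → ∀ x → lookup E x ≡ true → app σ x ≡ x
  restricted-fixes eq x x∈E =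
    ⌊⌋-true (app σ x ≟ x)
      (proj₁ (∧-true (trans (sym (lookup-fix∩upto σ s x)) (trans (cong (λ p → lookup p x) eq) x∈E))))

  restricted-complete : fix σ ∩ upto s ≡ E → ∀ x → app σ x ≡ x → toℕ x < s → lookup E x ≡ true
  restricted-complete eq x σx≡x x<s = begin
    lookup E x                      ≡⟨ cong (λ p → lookup p x) (sym eq) ⟩
    lookup (fix σ ∩ upto s) x       ≡⟨ lookup-fix∩upto σ s x ⟩
    ⌊ app σ x ≟ x ⌋ ∧ (toℕ x <ᵇ s)  ≡⟨ cong₂ _∧_ (⌊⌋-yes (app σ x ≟ x) σx≡x) (<⇒<ᵇ-true x<s) ⟩
    true                            ∎
    where open ≡-Reasoning

  restricted-intro : (∀ x → lookup E x ≡ true → app σ x ≡ x) → (∀ x → lookup E x ≡ true → toℕ x < s) →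
    (∀ x → app σ x ≡ x → toℕ x < s → lookup E x ≢ false) → fix σ ∩ upto s ≡ E
  restricted-intro fixes below complete = vec-ext _ E λ x → trans (lookup-fix∩upto σ s x) (pointwise x)
    where
    pointwise : ∀ x → ⌊ app σ x ≟ x ⌋ ∧ (toℕ x <ᵇ s) ≡ lookup E x
    pointwise x with lookup E x in x∈?E
    ... | true  = cong₂ _∧_ (⌊⌋-yes (app σ x ≟ x) (fixes x x∈?E)) (<⇒<ᵇ-true (below x x∈?E))
    ... | false with app σ x ≟ x
    ...   | no _      = refl
    ...   | yes σx≡x with toℕ x <ᵇ s in x<ᵇs
    ...     | false = refl
    ...     | true  = ⊥-elim (complete x σx≡x (<ᵇ-true x<ᵇs) x∈?E)

below-outside : ∀ {m} → ℕ → Subset m → Subset m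
below-outside s E = tabulate (λ x → (toℕ x <ᵇ s) ∧ not (lookup E x))

lookup-below-outside : ∀ {m} s (E : Subset m) x →
  lookup (below-outside s E) x ≡ (toℕ x <ᵇ s) ∧ not (lookup E x)
lookup-below-outside s E x = VecP.lookup∘tabulate _ x

∣∅∣≡0 : ∀ {m} (p : Subset m) → (∀ x → lookup p x ≢ true) → ∣ p ∣ ≡ 0
∣∅∣≡0 []          _     = refl
∣∅∣≡0 (true ∷ p)  empty = ⊥-elim (empty Fin.zero refl)
∣∅∣≡0 (false ∷ p) empty = ∣∅∣≡0 p (empty ∘ Fin.suc)

∣below-outside∣ : ∀ {m} (E : Subset m) s → s ≤ m → (∀ x → lookup E x ≡ true → toℕ x < s) →
  ∣ below-outside s E ∣ + ∣ E ∣ ≡ s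
∣below-outside∣ E zero _ E⊆[0] =
  cong₂ _+_ (∣∅∣≡0 (below-outside 0 E) (λ x x∈ → true≢false (trans (sym x∈) (lookup-below-outside 0 E x))))
            (∣∅∣≡0 E (λ x x∈E → ℕP.n≮0 (E⊆[0] x x∈E)))
∣below-outside∣ (true ∷ E)  (suc s) (s≤s s≤m) E⊆[1+s] =
  trans (ℕP.+-suc _ _) (cong suc (∣below-outside∣ E s s≤m (λ x x∈E → ℕP.≤-pred (E⊆[1+s] (Fin.suc x) x∈E))))
∣below-outside∣ (false ∷ E) (suc s) (s≤s s≤m) E⊆[1+s] =
  cong suc (∣below-outside∣ E s s≤m (λ x x∈E → ℕP.≤-pred (E⊆[1+s] (Fin.suc x) x∈E)))

hasSize-# : ∀ {n} {P : Family n} (P? : Decidable P) → HasSize P (# P?)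
hasSize-# {n} P? =
  filter P? (allArr n) , Unique.filter⁺ P? (allVec-unique n n) ,
  (λ σ → mk⇔ (proj₂ ∘ ∈-filter⁻ P? {xs = allArr n}) (∈-filter⁺ P? (allVec-complete n n σ))) , refl

-- 𝒟(Ê) for a generator Ê ∈ g ∈ G_* of maximal s⁺.

module TopGenerator {n} (g : Coll n) (g-star : ∀ E → Lstar g E ⇔ g E)
                    (Ê : Subset n) (gÊ : g Ê) (Ê-top : ∀ E → g E → sPlus E ≤ sPlus Ê) where
  open GeneratingStar g g-star
  open FixedPoints n
  open InclusionExclusion n

  s : ℕ
  s = sPlus Ê

  OtherGenerator : Family n
  OtherGenerator = Upᶜ (λ B → g B × B ≢ Ê)

  Ê-below : ∀ x → lookup Ê x ≡ true → toℕ x < s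
  Ê-below = sPlus-bound Ê

  -- a generator B inside fix σ lies in [s⁺(B)] ⊆ [s], hence inside fix σ ∩ [s] = Ê, hence is Ê
  D⇒no-other : ∀ σ → D Ê σ → ¬ OtherGenerator σ
  D⇒no-other σ (_ , eq) (B , (gB , B≢Ê) , _ , B⊆fix) = B≢Ê (generator-antichain gÊ gB B⊆Ê)
    where
    B⊆Ê : B ⊆ₛ Ê
    B⊆Ê {x} x∈B = VecP.lookup⇒[]= x Ê (restricted-complete σ Ê s eq x (fix⇒ σ (B⊆fix x∈B))
                    (ℕP.<-≤-trans (sPlus-bound B x (VecP.[]=⇒lookup x∈B)) (Ê-top B gB)))

  -- a fixed point x < s of σ outside Ê would give another generator inside fix σ: replacing
  -- the maximum M of Ê by x gives Ê′ ∈ ℒ(g) inside fix σ, and a generator below Ê′ misses M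
  no-other⇒no-extra : ∀ σ → IsPerm σ → Ê ⊆ₛ fix σ → ¬ OtherGenerator σ →
    ∀ x → app σ x ≡ x → toℕ x < s → lookup Ê x ≢ false
  no-other⇒no-extra σ σ-perm Ê⊆fix no-other x σx≡x x<s x∉Ê with sPlus-attained Ê
  ... | inj₁ s≡0 = ℕP.n≮0 (subst (toℕ x <_) s≡0 x<s)
  ... | inj₂ (M , M∈Ê , s≡1+M) =
    generator-below Ê′ (Ê , gÊ , shift-max-down Ê x M x∉Ê (M∈Ê , M-max) x<M) other-inside
    where
    M-max : ∀ y → lookup Ê y ≡ true → toℕ y ≤ toℕ M
    M-max y y∈Ê = ℕP.≤-pred (subst (toℕ y <_) s≡1+M (Ê-below y y∈Ê))
    x≢M : x ≢ M
    x≢M refl = true≢false (trans (sym M∈Ê) x∉Ê)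
    x<M : toℕ x < toℕ M
    x<M = ℕP.≤∧≢⇒< (ℕP.≤-pred (subst (toℕ x <_) s≡1+M x<s)) (x≢M ∘ FinP.toℕ-injective)
    Ê′ : Subset n
    Ê′ = (Ê Vec.[ M ]≔ false) Vec.[ x ]≔ true
    M∉Ê′ : lookup Ê′ M ≡ false
    M∉Ê′ = trans (VecP.lookup∘update′ (x≢M ∘ sym) (Ê Vec.[ M ]≔ false) true) (remove-gone Ê M)
    Ê′⊆fix : Ê′ ⊆ₛ fix σ
    Ê′⊆fix {y} y∈Ê′ with insert-member (Ê Vec.[ M ]≔ false) x (VecP.[]=⇒lookup y∈Ê′)
    ... | inj₁ refl = ⇒fix σ σx≡x
    ... | inj₂ y∈Ê-M = Ê⊆fix (VecP.lookup⇒[]= y Ê (remove-member Ê M y∈Ê-M))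
    other-inside : ∀ B → g B → B ⊆ₛ Ê′ → ⊥
    other-inside B gB B⊆Ê′ = no-other (B , (gB , B≢Ê) , σ-perm , Ê′⊆fix ∘ B⊆Ê′)
      where
      B≢Ê : B ≢ Ê
      B≢Ê refl = true≢false (trans (sym (VecP.[]=⇒lookup (B⊆Ê′ (VecP.lookup⇒[]= M Ê M∈Ê)))) M∉Ê′)

  D≐Up∖others : D Ê ≐ (λ σ → Up Ê σ × ¬ OtherGenerator σ)
  D≐Up∖others σ = mk⇔
    (λ { Dσ@(σ-perm , eq) → (σ-perm , λ {x} x∈Ê → ⇒fix σ (restricted-fixes σ Ê s eq x (VecP.[]=⇒lookup x∈Ê)))
                           , D⇒no-other σ Dσ })
    (λ { ((σ-perm , Ê⊆fix) , no-other) →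
         σ-perm , restricted-intro σ Ê s (λ x x∈Ê → fix⇒ σ (Ê⊆fix (VecP.lookup⇒[]= x Ê x∈Ê))) Ê-below
                    (no-other⇒no-extra σ σ-perm Ê⊆fix no-other) })

  R : Subset n
  R = below-outside s Ê

  R-member : ∀ x → lookup R x ≡ true → lookup Ê x ≡ false × toℕ x < s
  R-member x x∈R with toℕ x <ᵇ s in x<ᵇs | lookup Ê x | trans (sym (lookup-below-outside s Ê x)) x∈R
  ... | true | false | _ = refl , <ᵇ-true x<ᵇs

  Ê∩R=∅ : Disjoint Ê R
  Ê∩R=∅ x x∈Ê x∈R = true≢false (trans (sym x∈Ê) (proj₁ (R-member x x∈R)))

  ∣R∣≡s∸∣Ê∣ : ∣ R ∣ ≡ s ∸ ∣ Ê ∣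
  ∣R∣≡s∸∣Ê∣ =
    trans (sym (ℕP.m+n∸n≡m ∣ R ∣ ∣ Ê ∣)) (cong (_∸ ∣ Ê ∣) (∣below-outside∣ Ê s (sPlus-≤ Ê) Ê-below))

  D⇒fixing-avoiding : ∀ σ → D Ê σ → IsPerm σ × Fixes Ê σ × Avoids R σ
  D⇒fixing-avoiding σ (σ-perm , eq) =
    σ-perm , restricted-fixes σ Ê s eq , λ x x∈R σx≡x →
      let (x∉Ê , x<s) = R-member x x∈R in
      true≢false (trans (sym (restricted-complete σ Ê s eq x σx≡x x<s)) x∉Ê)

  fixing-avoiding⇒D : ∀ σ → IsPerm σ × Fixes Ê σ × Avoids R σ → D Ê σ
  fixing-avoiding⇒D σ (σ-perm , σ-fixes , σ-avoids) =
    σ-perm , restricted-intro σ Ê s σ-fixes Ê-below λ x σx≡x x<s x∉Ê →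
      σ-avoids x (trans (lookup-below-outside s Ê x) (cong₂ _∧_ (<⇒<ᵇ-true x<s) (cong not x∉Ê))) σx≡x

  D? : Decidable (D Ê)
  D? σ = isPerm? σ ×-dec VecP.≡-dec Bool._≟_ (fix σ ∩ upto s) Ê

  #D≡incExc : + # D? ≡ incExc n ∣ Ê ∣ (s ∸ ∣ Ê ∣)
  #D≡incExc = begin
    + # D?                     ≡⟨ cong +_ (count-≐ D? (fixing-avoiding? Ê R) D⇒fixing-avoiding fixing-avoiding⇒D
                                                   (allArr n)) ⟩
    + # fixing-avoiding? Ê R   ≡⟨ #fixing-avoiding (s ∸ ∣ Ê ∣) Ê R ∣R∣≡s∸∣Ê∣ Ê∩R=∅ ⟩
    incExc n ∣ Ê ∣ (s ∸ ∣ Ê ∣)  ∎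
    where open ≡-Reasoning

-- Lemma 2.15: both claims hold already for any g satisfying g = ℒ_*(g).
lemma2p15 : (n t : ℕ) → 0 < t → (𝒜 : Family n) →
    Maximal n t 𝒜 → Fixed 𝒜 → Compressed 𝒜 →
    (g : Coll n) → IsGeneratingStar 𝒜 g →
    (Ê : Subset n) → g Ê → (∀ E → g E → sPlus E ≤ sPlus Ê) →
    (D Ê ≐ (λ σ → Up Ê σ × ¬ Upᶜ (λ B → g B × B ≢ Ê) σ))
    ×
    Σ ℕ (λ k → HasSize (D Ê) k ×
      + k ≡ sumTo (sPlus Ê ∸ ∣ Ê ∣) (λ j →
              (-1ℤ ^ j) * + (((sPlus Ê ∸ ∣ Ê ∣) C j) *ℕ ((n ∸ ∣ Ê ∣ ∸ j) !))))
lemma2p15 n _ _ _ _ _ _ g (_ , g-star) Ê gÊ Ê-top = D≐Up∖others , # D? , hasSize-# D? , #D≡incExc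
  where open TopGenerator g g-star Ê gÊ Ê-top
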